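{- Let $k,\ell,\ell'\in\mathbb N^+$, $r\in\mathbb N$ and $M$ a finite subset of $\mathbb N^+$. If $\widehat{\mathfrak G}_{k\ell}\equiv_r^M\widehat{\mathfrak G}_{k\ell'}$, then $\mathfrak G_{k\ell}\equiv_r^M\mathfrak G_{k\ell'}$.
   Context: For $k,\ell\in\mathbb N^+$, the cliquey $(k,\ell)$-grid $\mathfrak G_{k\ell}$ is the $\{\sim_h,\sim_v\}$-structure with universe $\{0,\dots,k-1\}\times\{0,\dots,\ell-1\}$, where $(x,y)\sim_h(x',y')$ iff $x=x'$ and $(x,y)\sim_v(x',y')$ iff $y=y'$. The horizontally coloured cliquey $(k,\ell)$-grid $\widehat{\mathfrak G}_{k\ell}$ is the $\{\sim_v,P_1,\dots,P_k\}$-structure with the same universe and the same $\sim_v$, and with unary predicates $P_i=\{(i-1,y):0\le y<\ell\}$ for $1\le i\le k$. For $r\in\mathbb N$ and finite $M\subseteq\mathbb N^+$, $\mathfrak A\equiv_r^M\mathfrak B$ means that $\mathfrak A$ and $\mathfrak B$ satisfy the same sentences of $\mathrm{CMSO}^{(M)}$ of quantifier rank at most $r$, where $\mathrm{CMSO}^{(M)}$ is monadic second-order logic extended by atomic predicates $C^{(m,q)}(X)$ ($X$ a set variable, $m\in M$, $0\le q<m$) expressing $|X|\equiv q\pmod m$, and quantifier rank counts first-order and set quantifiers as in MSO. -}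

module Defs where

open import Data.Nat using (ℕ; zero; suc; _*_; _%_; _≡ᵇ_; _⊔_)
open import Data.Fin using (Fin; zero; suc; toℕ; remQuot; _≟_)
open import Data.Fin.Subset using (Subset; ∣_∣)
open import Data.Vec using (Vec; []; _∷_; lookup; map)
open import Data.Bool using (Bool; true; false; not; _∨_; _∧_)
open import Data.List using (List)
open import Data.List.Membership.Propositional using (_∈_)
open import Data.Product using (_×_; _,_; proj₁; proj₂)
open import Relation.Nullary.Decidable using (isYes)
open import Relation.Binary.PropositionalEquality using (_≡_)

record Vocab : Set where
  field
    nsym  : ℕ
    arity : Fin nsym → ℕ
open Vocab public

record Str (V : Vocab) : Set where
  field
    size : ℕ
    rel  : (R : Fin (nsym V)) → Vec (Fin size) (arity V R) → Bool
open Str public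

-- CMSO^(M) syntax (de Bruijn): Formula V M n s has n free first-order
-- variables and s free set variables.

data Formula (V : Vocab) (M : List ℕ) : ℕ → ℕ → Set where
  atom : ∀ {n s} (R : Fin (nsym V)) → Vec (Fin n) (arity V R) → Formula V M n s
  eq   : ∀ {n s} → Fin n → Fin n → Formula V M n s
  mem  : ∀ {n s} → Fin n → Fin s → Formula V M n s
  -- C^(m,q)(X) : |X| ≡ q (mod m), for m ∈ M and 0 ≤ q < m
  cnt  : ∀ {n s} (m : ℕ) → m ∈ M → (q : Fin m) → Fin s → Formula V M n s
  neg  : ∀ {n s} → Formula V M n s → Formula V M n s
  or   : ∀ {n s} → Formula V M n s → Formula V M n s → Formula V M n s
  ex1  : ∀ {n s} → Formula V M (suc n) s → Formula V M n s
  exS  : ∀ {n s} → Formula V M n (suc s) → Formula V M n s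

Sentence : Vocab → List ℕ → Set
Sentence V M = Formula V M 0 0

qr : ∀ {V M n s} → Formula V M n s → ℕ
qr (atom R xs)   = 0
qr (eq x y)     = 0
qr (mem x X)    = 0
qr (cnt m _ q X) = 0
qr (neg φ)      = qr φ
qr (or φ ψ)     = qr φ ⊔ qr ψ
qr (ex1 φ)      = suc (qr φ)
qr (exS φ)      = suc (qr φ)

anyFin : (N : ℕ) → (Fin N → Bool) → Bool
anyFin zero    f = false
anyFin (suc N) f = f zero ∨ anyFin N (λ i → f (suc i))

anySubset : (N : ℕ) → (Subset N → Bool) → Bool
anySubset zero    f = f []
anySubset (suc N) f = anySubset N (λ X → f (true ∷ X)) ∨ anySubset N (λ X → f (false ∷ X))

modEq : ℕ → (m : ℕ) → Fin m → Bool
modEq c zero    ()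
modEq c (suc m) q = (c % suc m) ≡ᵇ toℕ q

eval : ∀ {V M n s} (A : Str V) → Formula V M n s →
       Vec (Fin (size A)) n → Vec (Subset (size A)) s → Bool
eval A (atom R xs)    ρ σ = rel A R (map (λ x → lookup ρ x) xs)
eval A (eq x y)      ρ σ = isYes (lookup ρ x ≟ lookup ρ y)
eval A (mem x X)     ρ σ = lookup (lookup σ X) (lookup ρ x)
eval A (cnt m _ q X) ρ σ = modEq ∣ lookup σ X ∣ m q
eval A (neg φ)       ρ σ = not (eval A φ ρ σ)
eval A (or φ ψ)      ρ σ = eval A φ ρ σ ∨ eval A ψ ρ σ
eval A (ex1 φ)       ρ σ = anyFin (size A) (λ a → eval A φ (a ∷ ρ) σ)
eval A (exS φ)       ρ σ = anySubset (size A) (λ X → eval A φ ρ (X ∷ σ))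

_⊨_ : ∀ {V M} → Str V → Sentence V M → Bool
A ⊨ φ = eval A φ [] []

Equiv : (V : Vocab) (r : ℕ) (M : List ℕ) → Str V → Str V → Set
Equiv V r M A B = (φ : Sentence V M) → qr φ Data.Nat.≤ r → (A ⊨ φ) ≡ (B ⊨ φ)

-- Grids.  The universe {0..k-1}×{0..ℓ-1} is encoded as Fin (k * ℓ)
-- via the bijection remQuot ℓ : Fin (k * ℓ) → Fin k × Fin ℓ.

coord : (k ℓ : ℕ) → Fin (k * ℓ) → Fin k × Fin ℓ
coord k ℓ = remQuot {k} ℓ

-- vocabulary {∼h, ∼v}: symbol 0 = ∼h, symbol 1 = ∼v, both binary
GridVocab : Vocab
GridVocab = record { nsym = 2 ; arity = λ _ → 2 }

-- vocabulary {∼v, P_1..P_k}: symbol 0 = ∼v (binary), symbol (suc i) = P_(i+1) (unary)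
ColVocab : ℕ → Vocab
ColVocab k = record { nsym = suc k ; arity = ar }
  where
  ar : Fin (suc k) → ℕ
  ar zero    = 2
  ar (suc _) = 1

sameX : (k ℓ : ℕ) → Fin (k * ℓ) → Fin (k * ℓ) → Bool
sameX k ℓ a b = isYes (proj₁ (coord k ℓ a) ≟ proj₁ (coord k ℓ b))

sameY : (k ℓ : ℕ) → Fin (k * ℓ) → Fin (k * ℓ) → Bool
sameY k ℓ a b = isYes (proj₂ (coord k ℓ a) ≟ proj₂ (coord k ℓ b))

Grid : (k ℓ : ℕ) → Str GridVocab
Grid k ℓ = record { size = k * ℓ ; rel = R }
  where
  R : (S : Fin 2) → Vec (Fin (k * ℓ)) 2 → Bool
  R zero       (a ∷ b ∷ []) = sameX k ℓ a b
  R (suc zero) (a ∷ b ∷ []) = sameY k ℓ a b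

ColGrid : (k ℓ : ℕ) → Str (ColVocab k)
ColGrid k ℓ = record { size = k * ℓ ; rel = R }
  where
  R : (S : Fin (suc k)) → Vec (Fin (k * ℓ)) (arity (ColVocab k) S) → Bool
  R zero    (a ∷ b ∷ []) = sameY k ℓ a b
  R (suc i) (a ∷ [])     = isYes (proj₁ (coord k ℓ a) ≟ i)      -- P_(i+1) = {(i,y)}

module Submission where

-- The grid 𝔊_kℓ is first-order interpretable in the coloured
-- grid 𝔊̂_kℓ on the same universe, uniformly in ℓ and without quantifiers:
-- ∼v is kept, and x ∼h y (same column) becomes ⋁_{i<k} (P_i x ∧ P_i y).
-- Replacing every atom of a CMSO^(M) formula by its defining formula gives
-- a translation φ ↦ φ* with qr φ* = qr φ and 𝔊̂_kℓ ⊨ φ* ⟺ 𝔊_kℓ ⊨ φ, so an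
-- equivalence of the coloured grids transfers to the uncoloured ones.

open import Defs
open import Data.Nat using (ℕ; _<_; zero; suc; _⊔_)
open import Data.Nat.Properties using (≤-reflexive; ≤-trans)
open import Data.List using (List)
open import Data.List.Relation.Unary.All using (All)
open import Data.Fin using (Fin; zero; suc; _≟_)
open import Data.Fin.Subset using (Subset)
open import Data.Vec using (Vec; []; _∷_; lookup; map)
open import Data.Bool using (Bool; true; false; not; _∨_; _∧_)
open import Data.Bool.Properties using (∨-assoc; ∨-identityʳ; ∧-identityʳ; ∧-zeroʳ; not-involutive)
open import Data.Product using (proj₁)
open import Relation.Nullary.Decidable using (isYes; isYes≗does; dec-true)
open import Relation.Binary.PropositionalEquality using (_≡_; refl; sym; trans; cong; cong₂; module ≡-Reasoning)

not-∨-not : ∀ a b → not (not a ∨ not b) ≡ a ∧ b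
not-∨-not true  b = not-involutive b
not-∨-not false b = refl

isYes-≟-refl : ∀ {N} (a : Fin N) → isYes (a ≟ a) ≡ true
isYes-≟-refl a = trans (isYes≗does (a ≟ a)) (dec-true (a ≟ a) refl)

isYes-≟-suc : ∀ {N} (u v : Fin N) → isYes (suc u ≟ suc v) ≡ isYes (u ≟ v)
isYes-≟-suc u v = trans (isYes≗does (suc u ≟ suc v)) (sym (isYes≗does (u ≟ v)))

anyFin-cong : ∀ N {f g : Fin N → Bool} → (∀ i → f i ≡ g i) → anyFin N f ≡ anyFin N g
anyFin-cong zero    f≗g = refl
anyFin-cong (suc N) f≗g = cong₂ _∨_ (f≗g zero) (anyFin-cong N (λ i → f≗g (suc i)))

anySubset-cong : ∀ N {f g : Subset N → Bool} → (∀ X → f X ≡ g X) → anySubset N f ≡ anySubset N g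
anySubset-cong zero    f≗g = f≗g []
anySubset-cong (suc N) f≗g =
  cong₂ _∨_ (anySubset-cong N (λ X → f≗g (true ∷ X))) (anySubset-cong N (λ X → f≗g (false ∷ X)))

anyFin-false : ∀ N (f : Fin N → Bool) → anyFin N (λ i → f i ∧ false) ≡ false
anyFin-false zero    f = refl
anyFin-false (suc N) f rewrite ∧-zeroʳ (f zero) = anyFin-false N (λ i → f (suc i))

anyFin-point : ∀ N (f : Fin N → Bool) (v : Fin N) → anyFin N (λ i → f i ∧ isYes (v ≟ i)) ≡ f v
anyFin-point (suc N) f zero
  rewrite ∧-identityʳ (f zero) | anyFin-false N (λ i → f (suc i)) = ∨-identityʳ (f zero)
anyFin-point (suc N) f (suc v)
  rewrite ∧-zeroʳ (f zero) =
    trans (anyFin-cong N (λ i → cong (f (suc i) ∧_) (isYes-≟-suc v i)))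
          (anyFin-point N (λ i → f (suc i)) v)

module _ {V : Vocab} {M : List ℕ} where

  conj : ∀ {n s} → Formula V M n s → Formula V M n s → Formula V M n s
  conj φ ψ = neg (or (neg φ) (neg ψ))

  falsum : ∀ {n s} → Fin n → Formula V M n s
  falsum x = neg (eq x x)

  bigOr : ∀ {n s} (N : ℕ) → (Fin N → Formula V M n s) → Formula V M n s → Formula V M n s
  bigOr zero    f base = base
  bigOr (suc N) f base = or (f zero) (bigOr N (λ i → f (suc i)) base)

  qr-bigOr : ∀ {n s} N (f : Fin N → Formula V M n s) base →
             (∀ i → qr (f i) ≡ 0) → qr base ≡ 0 → qr (bigOr N f base) ≡ 0
  qr-bigOr zero    f base f0 b0 = b0
  qr-bigOr (suc N) f base f0 b0
    rewrite f0 zero | qr-bigOr N (λ i → f (suc i)) base (λ i → f0 (suc i)) b0 = refl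

  module _ (A : Str V) {n s} (ρ : Vec (Fin (size A)) n) (σ : Vec (Subset (size A)) s) where

    eval-conj : ∀ φ ψ → eval A (conj φ ψ) ρ σ ≡ (eval A φ ρ σ ∧ eval A ψ ρ σ)
    eval-conj φ ψ = not-∨-not (eval A φ ρ σ) (eval A ψ ρ σ)

    eval-falsum : ∀ x → eval A (falsum x) ρ σ ≡ false
    eval-falsum x = cong not (isYes-≟-refl (lookup ρ x))

    eval-bigOr : ∀ N f base →
      eval A (bigOr N f base) ρ σ ≡ (anyFin N (λ i → eval A (f i) ρ σ) ∨ eval A base ρ σ)
    eval-bigOr zero    f base = refl
    eval-bigOr (suc N) f base
      rewrite eval-bigOr N (λ i → f (suc i)) base = sym (∨-assoc (eval A (f zero) ρ σ) _ _)

onUniverseOf : ∀ {V W} (B : Str W) →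
  ((R : Fin (nsym V)) → Vec (Fin (size B)) (arity V R) → Bool) → Str V
onUniverseOf B relA = record { size = size B ; rel = relA }

module Interpretation {V W : Vocab} {M : List ℕ}
  (τ : ∀ {n s} (R : Fin (nsym V)) → Vec (Fin n) (arity V R) → Formula W M n s)
  (τ-qf : ∀ {n s} R (xs : Vec (Fin n) (arity V R)) → qr (τ {n} {s} R xs) ≡ 0) where

  translate : ∀ {n s} → Formula V M n s → Formula W M n s
  translate (atom R xs)   = τ R xs
  translate (eq x y)      = eq x y
  translate (mem x X)     = mem x X
  translate (cnt m p q X) = cnt m p q X
  translate (neg φ)       = neg (translate φ)
  translate (or φ ψ)      = or (translate φ) (translate ψ)
  translate (ex1 φ)       = ex1 (translate φ)
  translate (exS φ)       = exS (translate φ)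

  qr-translate : ∀ {n s} (φ : Formula V M n s) → qr (translate φ) ≡ qr φ
  qr-translate (atom R xs)   = τ-qf R xs
  qr-translate (eq x y)      = refl
  qr-translate (mem x X)     = refl
  qr-translate (cnt m p q X) = refl
  qr-translate (neg φ)       = qr-translate φ
  qr-translate (or φ ψ)      = cong₂ _⊔_ (qr-translate φ) (qr-translate ψ)
  qr-translate (ex1 φ)       = cong suc (qr-translate φ)
  qr-translate (exS φ)       = cong suc (qr-translate φ)

  Defines : (B : Str W) → ((R : Fin (nsym V)) → Vec (Fin (size B)) (arity V R) → Bool) → Set
  Defines B relA = ∀ {n s} R xs (ρ : Vec (Fin (size B)) n) (σ : Vec (Subset (size B)) s) →
    eval B (τ R xs) ρ σ ≡ relA R (map (λ x → lookup ρ x) xs)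

  module _ (B : Str W) relA (τ-defines : Defines B relA) where

    eval-translate : ∀ {n s} (φ : Formula V M n s) ρ σ →
      eval B (translate φ) ρ σ ≡ eval (onUniverseOf B relA) φ ρ σ
    eval-translate (atom R xs)   ρ σ = τ-defines R xs ρ σ
    eval-translate (eq x y)      ρ σ = refl
    eval-translate (mem x X)     ρ σ = refl
    eval-translate (cnt m p q X) ρ σ = refl
    eval-translate (neg φ)       ρ σ = cong not (eval-translate φ ρ σ)
    eval-translate (or φ ψ)      ρ σ = cong₂ _∨_ (eval-translate φ ρ σ) (eval-translate ψ ρ σ)
    eval-translate (ex1 φ)       ρ σ = anyFin-cong (size B) (λ a → eval-translate φ (a ∷ ρ) σ)
    eval-translate (exS φ)       ρ σ = anySubset-cong (size B) (λ X → eval-translate φ ρ (X ∷ σ))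

  transfer : ∀ {r} B relA B' relA' → Defines B relA → Defines B' relA' →
    Equiv W r M B B' → Equiv V r M (onUniverseOf B relA) (onUniverseOf B' relA')
  transfer B relA B' relA' def def' B≡B' φ qrφ≤r = begin
    onUniverseOf B relA ⊨ φ     ≡⟨ sym (eval-translate B relA def φ [] []) ⟩
    B ⊨ translate φ             ≡⟨ B≡B' (translate φ) (≤-trans (≤-reflexive (qr-translate φ)) qrφ≤r) ⟩
    B' ⊨ translate φ            ≡⟨ eval-translate B' relA' def' φ [] [] ⟩
    onUniverseOf B' relA' ⊨ φ   ∎
    where open ≡-Reasoning

module _ {M : List ℕ} (k : ℕ) where

  colour : ∀ {n s} → Fin k → Fin n → Formula (ColVocab k) M n s
  colour i x = atom (suc i) (x ∷ [])

  sameColumn : ∀ {n s} → Fin n → Fin n → Formula (ColVocab k) M n s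
  sameColumn x y = bigOr k (λ i → conj (colour i x) (colour i y)) (falsum x)

  gridτ : ∀ {n s} (R : Fin 2) → Vec (Fin n) 2 → Formula (ColVocab k) M n s
  gridτ zero       (x ∷ y ∷ []) = sameColumn x y
  gridτ (suc zero) (x ∷ y ∷ []) = atom zero (x ∷ y ∷ [])

  gridτ-qf : ∀ {n s} R (xs : Vec (Fin n) 2) → qr (gridτ {n} {s} R xs) ≡ 0
  gridτ-qf zero       (x ∷ y ∷ []) = qr-bigOr k _ (falsum x) (λ i → refl) refl
  gridτ-qf (suc zero) (x ∷ y ∷ []) = refl

  open Interpretation {GridVocab} {ColVocab k} {M} gridτ gridτ-qf

  gridτ-defines : ∀ ℓ → Defines (ColGrid k ℓ) (rel (Grid k ℓ))
  gridτ-defines ℓ zero (x ∷ y ∷ []) ρ σ = begin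
    eval A (sameColumn x y) ρ σ
      ≡⟨ eval-bigOr A ρ σ k _ (falsum x) ⟩
    anyFin k (λ i → eval A (conj (colour i x) (colour i y)) ρ σ) ∨ eval A (falsum {M = M} x) ρ σ
      ≡⟨ cong₂ _∨_ (anyFin-cong k (λ i → eval-conj A ρ σ (colour i x) (colour i y)))
                   (eval-falsum {M = M} A ρ σ x) ⟩
    anyFin k (λ i → isYes (u ≟ i) ∧ isYes (v ≟ i)) ∨ false
      ≡⟨ ∨-identityʳ _ ⟩
    anyFin k (λ i → isYes (u ≟ i) ∧ isYes (v ≟ i))
      ≡⟨ anyFin-point k (λ i → isYes (u ≟ i)) v ⟩
    isYes (u ≟ v) ∎
    where
    open ≡-Reasoning
    A = ColGrid k ℓ
    u = proj₁ (coord k ℓ (lookup ρ x))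
    v = proj₁ (coord k ℓ (lookup ρ y))
  gridτ-defines ℓ (suc zero) (x ∷ y ∷ []) ρ σ = refl

  grid-transfer : ∀ {r} ℓ ℓ' →
    Equiv (ColVocab k) r M (ColGrid k ℓ) (ColGrid k ℓ') →
    Equiv GridVocab r M (Grid k ℓ) (Grid k ℓ')
  grid-transfer ℓ ℓ' =
    transfer (ColGrid k ℓ) (rel (Grid k ℓ)) (ColGrid k ℓ') (rel (Grid k ℓ'))
             (gridτ-defines ℓ) (gridτ-defines ℓ')

lemma4p3 : (k ℓ ℓ' r : ℕ) (M : List ℕ) → 0 < k → 0 < ℓ → 0 < ℓ' → All (λ m → 0 < m) M →
    Equiv (ColVocab k) r M (ColGrid k ℓ) (ColGrid k ℓ') →
    Equiv GridVocab r M (Grid k ℓ) (Grid k ℓ')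
lemma4p3 k ℓ ℓ' r M _ _ _ _ = grid-transfer k ℓ ℓ'
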